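{- Let $\epsilon\in(0,1/2)$. Suppose $\mathcal F\subseteq 2^{[n]}$ is a non $2$-covering Sperner family such that there exists $A_0\in\mathcal F$ with $|A_0|\le\epsilon n$. Then \[ |\mathcal F|\le\left(1-\frac{1}{\binom{n}{\lfloor\epsilon n\rfloor}}\right)\binom{n}{\lfloor\frac{n-1}{2}\rfloor}+1. \]
   Context: A family $\mathcal F\subseteq2^{[n]}$ is a Sperner family (antichain) if $A\not\subseteq B$ for all distinct $A,B\in\mathcal F$. It is non $2$-covering if $A\cup B\ne[n]$ for every pair $A,B\in\mathcal F$. -}

module Defs where

open import Data.Nat using (ℕ)
open import Data.Fin.Subset using (Subset; _⊆_; _∪_; ⊤)
open import Data.List using (List)
open import Data.List.Membership.Propositional using (_∈_)
open import Relation.Binary.PropositionalEquality using (_≡_; _≢_)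
open import Relation.Nullary using (¬_)

-- A family F ⊆ 2^[n] is represented as a duplicate-free list of subsets of Fin n.

Sperner : {n : ℕ} → List (Subset n) → Set
Sperner F = ∀ {A B} → A ∈ F → B ∈ F → A ≢ B → ¬ (A ⊆ B)

Non2Covering : {n : ℕ} → List (Subset n) → Set
Non2Covering F = ∀ {A B} → A ∈ F → B ∈ F → A ∪ B ≢ ⊤

{-# OPTIONS --safe #-}
-- Say an ordering σ of [n] passes through A when A is the set of the first ∣A∣ entries
-- of σ; exactly ∣A∣! (n − ∣A∣)! orderings pass through A. As F is an antichain, σ passes
-- through at most one member of F, so ∑_{A ∈ F} ∣A∣! (n − ∣A∣)! plus the number of
-- orderings meeting no member of F is at most n! (LYM). For odd n each summand is at
-- least m! (n − m)! = n! / C(n, m), m = (n − 1) / 2. For n = 2t the t-sets are too cheap,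
-- and non-2-covering pays for them: if σ passes through a t-set A ∈ F, one of its
-- rotations by 1, …, t meets no member of F, because along rotations the level at which
-- F is met never drops, while after t rotations a member met at level ≥ t would contain
-- the complement of A. Rotations permute the orderings, so each t-set earns the extra
-- weight (t − 1)! t!, which lifts it to n! / C(n, m). Finally A₀ weighs at least
-- n! / C(n, k) with k = ⌊pn/q⌋ ≤ n/2, and comparing weights bounds ∣F∣.
module Submission where

open import Defs
open import Data.Bool using (Bool; true; false; if_then_else_; _∨_)
import Data.Bool.Properties as Bool
open import Data.Empty using (⊥-elim)
open import Data.Fin using (Fin; zero; suc; toℕ; punchIn)
import Data.Fin.Properties as Finₚ
open import Data.Fin.Subset using (Subset; ∣_∣; ⊤; ⊥; _⊆_; _∪_)
open import Data.Fin.Subset.Properties using (p⊆q⇒∣p∣≤∣q∣; ∣p∣≤n; ∣⊤∣≡n)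
open import Data.List using (List; []; _∷_; _++_; _∷ʳ_; length; take; drop)
import Data.List as List
open import Data.List.Membership.Propositional using (_∈_)
open import Data.List.Membership.Propositional.Properties using (∈-lookup; ∈-++⁻)
open import Data.List.Properties using (length-drop; take-all; take++drop≡id; ++-assoc; ++-identityʳ)
open import Data.List.Relation.Binary.Permutation.Propositional using (_↭_; ↭-sym; ↭⇒↭ₛ)
open import Data.List.Relation.Binary.Permutation.Propositional.Properties using (∷↭∷ʳ; ↭-length; ∈-resp-↭)
import Data.List.Relation.Binary.Permutation.Setoid.Properties as PermutationSetoid
open import Data.List.Relation.Unary.All as All using ()
open import Data.List.Relation.Unary.AllPairs as AllPairs using ([]; _∷_)
open import Data.List.Relation.Unary.Any as Any using (here; there)
open import Data.List.Relation.Unary.Any.Properties using (lookup-index)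
open import Data.List.Relation.Unary.Unique.Propositional using (Unique)
open import Data.Nat using (ℕ; zero; suc; _+_; _*_; _∸_; _≤_; _<_; z≤n; s≤s; z<s; _≤′_; ≤′-refl; ≤′-step;
                            NonZero; ≢-nonZero⁻¹; _!; _≟_; _≤?_)
open import Data.Nat.Combinatorics using (_C_; nCk≡n!/k![n-k]!; k![n∸k]!∣n!)
open import Data.Nat.DivMod using (_/_; _%_; m/n*n≡m; m/n*n≤m; m*n/n≡m; m/n≤m; /-monoˡ-≤; m%n<n; m≡m%n+[m/n]*n)
open import Data.Nat.Properties
open import Algebra.Properties.CommutativeMonoid.Sum +-0-commutativeMonoid
  using (sum-syntax; sum-cong-≗; sum-remove; ∑-distrib-+; ∑-comm)
open import Algebra.Properties.Semiring.Sum +-*-semiring using (*-distribˡ-sum)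
open import Data.Nat.Solver using (module +-*-Solver)
open import Data.Product using (Σ; ∃; _×_; _,_)
open import Data.Sum using (_⊎_; inj₁; inj₂)
open import Data.Vec using ([]; _∷_; lookup; _[_]≔_)
open import Data.Vec.Properties
  using (lookup∘update; lookup∘update′; lookup-replicate; lookup⇒[]=; []=⇒lookup; []≔-idempotent; []≔-lookup; []≔-commutes; ≡-dec)
open import Function using (_∘_; id)
open import Relation.Binary.Definitions using (DecidableEquality)
open import Relation.Binary.PropositionalEquality
open import Relation.Nullary using (Dec; yes; no; does; ¬_; ¬?; contradiction)
open import Relation.Unary using (Decidable)

𝟙 : ∀ {p} {P : Set p} → Dec P → ℕ
𝟙 (yes _) = 1
𝟙 (no _)  = 0

module _ {p} {P : Set p} where

  𝟙-yes : (P? : Dec P) → P → 𝟙 P? ≡ 1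
  𝟙-yes (yes _) _  = refl
  𝟙-yes (no ¬P) P = contradiction P ¬P

  𝟙-no : (P? : Dec P) → ¬ P → 𝟙 P? ≡ 0
  𝟙-no (yes P) ¬P = contradiction P ¬P
  𝟙-no (no _)  _  = refl

  𝟙-pos : (P? : Dec P) → 0 < 𝟙 P? → P
  𝟙-pos (yes P) _ = P

module _ {p q} {P : Set p} {Q : Set q} where

  𝟙-cong : (P? : Dec P) (Q? : Dec Q) → (P → Q) → (Q → P) → 𝟙 P? ≡ 𝟙 Q?
  𝟙-cong P? (yes Q) _   Q→P = 𝟙-yes P? (Q→P Q)
  𝟙-cong P? (no ¬Q) P→Q _   = 𝟙-no P? (¬Q ∘ P→Q)

if-congᵗ : ∀ b {x y : ℕ} → (b ≡ true → x ≡ y) → (if b then x else 0) ≡ (if b then y else 0)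
if-congᵗ true  x≡y = x≡y refl
if-congᵗ false _   = refl

if-monoᵗ : ∀ b {x y : ℕ} → (b ≡ true → x ≤ y) → (if b then x else 0) ≤ (if b then y else 0)
if-monoᵗ true  x≤y = x≤y refl
if-monoᵗ false _   = z≤n

if-≤ : ∀ b x → (if b then x else 0) ≤ x
if-≤ true  x = ≤-refl
if-≤ false x = z≤n

if-distrib-+ : ∀ b x y → (if b then x + y else 0) ≡ (if b then x else 0) + (if b then y else 0)
if-distrib-+ true  x y = refl
if-distrib-+ false x y = refl

x≤1⇒x≤y : ∀ {x y} → x ≤ 1 → (0 < x → 0 < y) → x ≤ y
x≤1⇒x≤y {zero}      _         _      = z≤n
x≤1⇒x≤y {suc zero}  _         0<x⇒0<y = 0<x⇒0<y z<s
x≤1⇒x≤y {suc (suc _)} (s≤s ()) _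

∑-mono-≤ : ∀ {m} {f g : Fin m → ℕ} → (∀ i → f i ≤ g i) → ∑[ i < m ] f i ≤ ∑[ i < m ] g i
∑-mono-≤ {zero}  f≤g = z≤n
∑-mono-≤ {suc m} f≤g = +-mono-≤ (f≤g zero) (∑-mono-≤ (f≤g ∘ suc))

∑-const : ∀ m c → ∑[ i < m ] c ≡ m * c
∑-const zero    c = refl
∑-const (suc m) c = cong (c +_) (∑-const m c)

∑-zero : ∀ {m} {f : Fin m → ℕ} → (∀ i → f i ≡ 0) → ∑[ i < m ] f i ≡ 0
∑-zero {zero}  f≡0 = refl
∑-zero {suc m} f≡0 = cong₂ _+_ (f≡0 zero) (∑-zero (f≡0 ∘ suc))

∑-positive : ∀ {m} (f : Fin m → ℕ) → 0 < ∑[ i < m ] f i → ∃ λ i → 0 < f i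
∑-positive {suc m} f 0<∑ with f zero in eq
... | suc _ = zero , subst (0 <_) (sym eq) z<s
... | zero  with ∑-positive (f ∘ suc) 0<∑
...   | i , 0<fi = suc i , 0<fi

∑-𝟙≤1 : ∀ {m p} {P : Fin m → Set p} (P? : Decidable P)
      → (∀ {i j} → P i → P j → i ≡ j) → ∑[ i < m ] 𝟙 (P? i) ≤ 1
∑-𝟙≤1 {zero}  P? once = z≤n
∑-𝟙≤1 {suc m} P? once with P? zero
... | yes P0 = ≤-reflexive (cong suc (∑-zero rest-absent))
  where
  rest-absent : ∀ i → 𝟙 (P? (suc i)) ≡ 0
  rest-absent i = 𝟙-no (P? (suc i)) λ Pi → contradiction (once P0 Pi) λ ()
... | no _ = ∑-𝟙≤1 (P? ∘ suc) (λ Pi Pj → Finₚ.suc-injective (once Pi Pj))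

if-∑ : ∀ b {m} (g : Fin m → ℕ) → (if b then ∑[ i < m ] g i else 0) ≡ ∑[ i < m ] (if b then g i else 0)
if-∑ true      g = refl
if-∑ false {m} g = sym (∑-zero {m} λ _ → refl)

∑-if-lookup : ∀ {n} (U : Subset n) c → ∑[ x < n ] (if lookup U x then c else 0) ≡ ∣ U ∣ * c
∑-if-lookup []          c = refl
∑-if-lookup (true  ∷ U) c = cong (c +_) (∑-if-lookup U c)
∑-if-lookup (false ∷ U) c = ∑-if-lookup U c

lookup-⊥ : ∀ {n} (y : Fin n) → lookup ⊥ y ≡ false
lookup-⊥ y = lookup-replicate y false

lookup-⊤ : ∀ {n} (y : Fin n) → lookup ⊤ y ≡ true
lookup-⊤ y = lookup-replicate y true

∣p∣≡0⇒p≡⊥ : ∀ {n} (p : Subset n) → ∣ p ∣ ≡ 0 → p ≡ ⊥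
∣p∣≡0⇒p≡⊥ []          _     = refl
∣p∣≡0⇒p≡⊥ (false ∷ p) ∣p∣≡0 = cong (false ∷_) (∣p∣≡0⇒p≡⊥ p ∣p∣≡0)

∣p[x]≔false∣ : ∀ {n} (p : Subset n) x → lookup p x ≡ true → suc ∣ p [ x ]≔ false ∣ ≡ ∣ p ∣
∣p[x]≔false∣ (true  ∷ p) zero    _    = refl
∣p[x]≔false∣ (true  ∷ p) (suc x) x∈p = cong suc (∣p[x]≔false∣ p x x∈p)
∣p[x]≔false∣ (false ∷ p) (suc x) x∈p = ∣p[x]≔false∣ p x x∈p

∣p∣≡1+m⇒∣p[x]≔false∣≡m : ∀ {n m} (p : Subset n) x → lookup p x ≡ true → ∣ p ∣ ≡ suc m → ∣ p [ x ]≔ false ∣ ≡ m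
∣p∣≡1+m⇒∣p[x]≔false∣≡m p x x∈p ∣p∣≡1+m = suc-injective (trans (∣p[x]≔false∣ p x x∈p) ∣p∣≡1+m)

lookup-⊆ : ∀ {n} {p q : Subset n} → (∀ {y} → lookup p y ≡ true → lookup q y ≡ true) → p ⊆ q
lookup-⊆ {q = q} p⊆q {y} y∈p = lookup⇒[]= y q (p⊆q ([]=⇒lookup y∈p))

lookup-∪≡⊤ : ∀ {n} {p q : Subset n} → (∀ y → lookup p y ≡ true ⊎ lookup q y ≡ true) → p ∪ q ≡ ⊤
lookup-∪≡⊤ {p = []}    {[]}    cover = refl
lookup-∪≡⊤ {p = b ∷ p} {c ∷ q} cover = cong₂ _∷_ (head-covered (cover zero)) (lookup-∪≡⊤ (cover ∘ suc))
  where
  head-covered : b ≡ true ⊎ c ≡ true → b ∨ c ≡ true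
  head-covered (inj₁ refl) = refl
  head-covered (inj₂ refl) = Bool.∨-zeroʳ b

toSubset : ∀ {n} → List (Fin n) → Subset n
toSubset []       = ⊥
toSubset (x ∷ xs) = toSubset xs [ x ]≔ true

∈⇒lookup-toSubset : ∀ {n} {y : Fin n} {xs} → y ∈ xs → lookup (toSubset xs) y ≡ true
∈⇒lookup-toSubset {xs = x ∷ xs} (here refl) = lookup∘update x (toSubset xs) true
∈⇒lookup-toSubset {y = y} {x ∷ xs} (there y∈xs) with x Finₚ.≟ y
... | yes refl = lookup∘update x (toSubset xs) true
... | no x≢y   = trans (lookup∘update′ (x≢y ∘ sym) (toSubset xs) true) (∈⇒lookup-toSubset y∈xs)

lookup-toSubset⇒∈ : ∀ {n} {y : Fin n} xs → lookup (toSubset xs) y ≡ true → y ∈ xs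
lookup-toSubset⇒∈ {y = y} []       y∈ = contradiction (trans (sym y∈) (lookup-⊥ y)) λ ()
lookup-toSubset⇒∈ {y = y} (x ∷ xs) y∈ with x Finₚ.≟ y
... | yes refl = here refl
... | no x≢y   = there (lookup-toSubset⇒∈ xs (trans (sym (lookup∘update′ (x≢y ∘ sym) (toSubset xs) true)) y∈))

toSubset-⊆ : ∀ {n} {xs ys : List (Fin n)} → (∀ {y} → y ∈ xs → y ∈ ys) → toSubset xs ⊆ toSubset ys
toSubset-⊆ {xs = xs} xs⊆ys = lookup-⊆ (∈⇒lookup-toSubset ∘ xs⊆ys ∘ lookup-toSubset⇒∈ xs)

module _ {A : Set} where

  take-++ˡ : ∀ {a} (xs ys : List A) → a ≤ length xs → take a (xs ++ ys) ≡ take a xs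
  take-++ˡ {zero}  xs       ys _         = refl
  take-++ˡ {suc a} (x ∷ xs) ys (s≤s a≤) = cong (x ∷_) (take-++ˡ xs ys a≤)

  ∈-take-mono : ∀ {a b} {y : A} xs → a ≤ b → y ∈ take a xs → y ∈ take b xs
  ∈-take-mono {suc a} {suc b} (x ∷ xs) (s≤s a≤b) (here y≡x)  = here y≡x
  ∈-take-mono {suc a} {suc b} (x ∷ xs) (s≤s a≤b) (there y∈) = there (∈-take-mono xs a≤b y∈)

  ∈-take : ∀ {a} {y : A} xs → y ∈ take a xs → y ∈ xs
  ∈-take {suc a} (x ∷ xs) (here y≡x)  = here y≡x
  ∈-take {suc a} (x ∷ xs) (there y∈) = there (∈-take xs y∈)

  rotate : List A → List A
  rotate []       = []
  rotate (x ∷ xs) = xs ∷ʳ x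

  rotate^ : ℕ → List A → List A
  rotate^ zero    = id
  rotate^ (suc r) = rotate^ r ∘ rotate

  rotate-↭ : ∀ xs → xs ↭ rotate xs
  rotate-↭ []       = _↭_.refl
  rotate-↭ (x ∷ xs) = ∷↭∷ʳ x xs

  rotate^-++ : ∀ r (xs ys : List A) → r ≤ length xs → rotate^ r (xs ++ ys) ≡ drop r xs ++ ys ++ take r xs
  rotate^-++ zero    xs       ys _        = sym (cong (xs ++_) (++-identityʳ ys))
  rotate^-++ (suc r) (x ∷ xs) ys (s≤s r≤) = begin
    rotate^ r ((xs ++ ys) ∷ʳ x)      ≡⟨ cong (rotate^ r) (++-assoc xs ys (x ∷ [])) ⟩
    rotate^ r (xs ++ ys ∷ʳ x)        ≡⟨ rotate^-++ r xs (ys ∷ʳ x) r≤ ⟩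
    drop r xs ++ ys ∷ʳ x ++ take r xs ≡⟨ cong (drop r xs ++_) (++-assoc ys (x ∷ []) (take r xs)) ⟩
    drop r xs ++ ys ++ x ∷ take r xs ∎
    where open ≡-Reasoning

  rotate^≡drop++take : ∀ r (xs : List A) → r ≤ length xs → rotate^ r xs ≡ drop r xs ++ take r xs
  rotate^≡drop++take r xs r≤ = begin
    rotate^ r xs               ≡⟨ cong (rotate^ r) (sym (++-identityʳ xs)) ⟩
    rotate^ r (xs ++ [])       ≡⟨ rotate^-++ r xs [] r≤ ⟩
    drop r xs ++ take r xs     ∎
    where open ≡-Reasoning

infix 4 _≟ₛ_
_≟ₛ_ : ∀ {n} → DecidableEquality (Subset n)
_≟ₛ_ = ≡-dec Bool._≟_

[]≔-restore : ∀ {n} (p : Subset n) x {b} → (p [ x ]≔ b) [ x ]≔ lookup p x ≡ p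
[]≔-restore p x = trans ([]≔-idempotent p x) ([]≔-lookup p x)

p[x]≔true≡q⇒p≡q[x]≔false : ∀ {n} {p q : Subset n} x → lookup p x ≡ false → p [ x ]≔ true ≡ q → p ≡ q [ x ]≔ false
p[x]≔true≡q⇒p≡q[x]≔false {p = p} x x∉p refl = sym (trans (cong (λ b → p [ x ]≔ true [ x ]≔ b) (sym x∉p)) ([]≔-restore p x))

p≡q[x]≔false⇒p[x]≔true≡q : ∀ {n} {p q : Subset n} x → lookup q x ≡ true → p ≡ q [ x ]≔ false → p [ x ]≔ true ≡ q
p≡q[x]≔false⇒p[x]≔true≡q {q = q} x x∈q refl = trans (cong (λ b → q [ x ]≔ false [ x ]≔ b) (sym x∈q)) ([]≔-restore q x)

[x]≔false-⊆ : ∀ {n} {p q : Subset n} x → (∀ {y} → lookup p y ≡ true → lookup q y ≡ true)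
            → ∀ {y} → lookup (p [ x ]≔ false) y ≡ true → lookup (q [ x ]≔ false) y ≡ true
[x]≔false-⊆ {p = p} {q} x p⊆q {y} y∈p-x with x Finₚ.≟ y
... | yes refl = contradiction (trans (sym y∈p-x) (lookup∘update x p false)) λ ()
... | no x≢y   = trans (lookup∘update′ (x≢y ∘ sym) q false) (p⊆q (trans (sym (lookup∘update′ (x≢y ∘ sym) p false)) y∈p-x))

-- ∑ord k U f sums f over the duplicate-free lists of length k with entries in U;
-- for k ≡ ∣ U ∣ these are the orderings of U.
∑ord : ∀ {n} → ℕ → Subset n → (List (Fin n) → ℕ) → ℕ
∑ord     zero    U f = f []
∑ord {n} (suc k) U f = ∑[ x < n ] (if lookup U x then ∑ord k (U [ x ]≔ false) (f ∘ (x ∷_)) else 0)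

record IsOrdering {n} (k : ℕ) (U : Subset n) (σ : List (Fin n)) : Set where
  field
    length≡  : length σ ≡ k
    unique   : Unique σ
    sound    : ∀ {y} → y ∈ σ → lookup U y ≡ true
    complete : ∀ {y} → lookup U y ≡ true → y ∈ σ

IsOrdering-[] : ∀ {n} {U : Subset n} → ∣ U ∣ ≡ 0 → IsOrdering 0 U []
IsOrdering-[] {U = U} ∣U∣≡0 = record
  { length≡  = refl
  ; unique   = []
  ; sound    = λ ()
  ; complete = λ {y} y∈U → contradiction (trans (sym y∈U) (U-empty y)) λ ()
  }
  where
  U-empty : ∀ y → lookup U y ≡ false
  U-empty y = trans (cong (λ V → lookup V y) (∣p∣≡0⇒p≡⊥ U ∣U∣≡0)) (lookup-⊥ y)

module _ {n} {k : ℕ} {U : Subset n} where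

  IsOrdering-∷ : ∀ {x τ} → lookup U x ≡ true → IsOrdering k (U [ x ]≔ false) τ → IsOrdering (suc k) U (x ∷ τ)
  IsOrdering-∷ {x} {τ} x∈U τ-ord = record
    { length≡  = cong suc length≡
    ; unique   = All.tabulate (λ y∈τ → ≢x y∈τ ∘ sym) ∷ unique
    ; sound    = λ { (here refl) → x∈U ; (there y∈τ) → trans (sym (lookup∘update′ (≢x y∈τ) U false)) (sound y∈τ) }
    ; complete = complete′
    }
    where
    open IsOrdering τ-ord
    ≢x : ∀ {y} → y ∈ τ → y ≢ x
    ≢x {y} y∈τ refl = contradiction (trans (sym (sound y∈τ)) (lookup∘update x U false)) λ ()
    complete′ : ∀ {y} → lookup U y ≡ true → y ∈ x ∷ τ
    complete′ {y} y∈U with x Finₚ.≟ y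
    ... | yes refl = here refl
    ... | no x≢y   = there (complete (trans (lookup∘update′ (x≢y ∘ sym) U false) y∈U))

  IsOrdering-resp-↭ : ∀ {σ τ} → σ ↭ τ → IsOrdering k U σ → IsOrdering k U τ
  IsOrdering-resp-↭ σ↭τ σ-ord = record
    { length≡  = trans (sym (↭-length σ↭τ)) length≡
    ; unique   = PermutationSetoid.Unique-resp-↭ (setoid _) (↭⇒↭ₛ σ↭τ) unique
    ; sound    = sound ∘ ∈-resp-↭ (↭-sym σ↭τ)
    ; complete = ∈-resp-↭ σ↭τ ∘ complete
    }
    where open IsOrdering σ-ord

module _ {n : ℕ} where

  ∑ord-mono : ∀ k {U : Subset n} {f g} → ∣ U ∣ ≡ k
            → (∀ σ → IsOrdering k U σ → f σ ≤ g σ) → ∑ord k U f ≤ ∑ord k U g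
  ∑ord-mono zero    ∣U∣≡0 f≤g = f≤g [] (IsOrdering-[] ∣U∣≡0)
  ∑ord-mono (suc k) {U} ∣U∣≡1+k f≤g = ∑-mono-≤ λ x → if-monoᵗ (lookup U x) λ x∈U →
    ∑ord-mono k (∣p∣≡1+m⇒∣p[x]≔false∣≡m U x x∈U ∣U∣≡1+k)
      (λ τ τ-ord → f≤g (x ∷ τ) (IsOrdering-∷ x∈U τ-ord))

  ∑ord-cong : ∀ k {U : Subset n} {f g} → ∣ U ∣ ≡ k
            → (∀ σ → IsOrdering k U σ → f σ ≡ g σ) → ∑ord k U f ≡ ∑ord k U g
  ∑ord-cong k ∣U∣≡k f≡g = ≤-antisym
    (∑ord-mono k ∣U∣≡k λ σ σ-ord → ≤-reflexive (f≡g σ σ-ord))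
    (∑ord-mono k ∣U∣≡k λ σ σ-ord → ≤-reflexive (sym (f≡g σ σ-ord)))

  ∑ord-const : ∀ k {U : Subset n} c → ∣ U ∣ ≡ k → ∑ord k U (λ _ → c) ≡ k ! * c
  ∑ord-const zero    c _ = sym (+-identityʳ c)
  ∑ord-const (suc k) {U} c ∣U∣≡1+k = begin
    ∑[ x < n ] (if lookup U x then ∑ord k (U [ x ]≔ false) (λ _ → c) else 0)
      ≡⟨ sum-cong-≗ (λ x → if-congᵗ (lookup U x) λ x∈U →
           ∑ord-const k c (∣p∣≡1+m⇒∣p[x]≔false∣≡m U x x∈U ∣U∣≡1+k)) ⟩
    ∑[ x < n ] (if lookup U x then k ! * c else 0)  ≡⟨ ∑-if-lookup U (k ! * c) ⟩
    ∣ U ∣ * (k ! * c)                                ≡⟨ cong (_* (k ! * c)) ∣U∣≡1+k ⟩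
    suc k * (k ! * c)                                ≡⟨ *-assoc (suc k) (k !) c ⟨
    suc k ! * c                                      ∎
    where open ≡-Reasoning

  ∑ord-zero : ∀ k (U : Subset n) → ∑ord k U (λ _ → 0) ≡ 0
  ∑ord-zero zero    U = refl
  ∑ord-zero (suc k) U = ∑-zero λ x → trans (if-congᵗ (lookup U x) λ _ → ∑ord-zero k _) (if-zero (lookup U x))
    where
    if-zero : ∀ b → (if b then 0 else 0) ≡ 0
    if-zero true  = refl
    if-zero false = refl

  ∑ord-+ : ∀ k (U : Subset n) f g → ∑ord k U (λ σ → f σ + g σ) ≡ ∑ord k U f + ∑ord k U g
  ∑ord-+ zero    U f g = refl
  ∑ord-+ (suc k) U f g = trans
    (sum-cong-≗ λ x → trans (if-congᵗ (lookup U x) λ _ → ∑ord-+ k (U [ x ]≔ false) (f ∘ (x ∷_)) (g ∘ (x ∷_)))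
                                 (if-distrib-+ (lookup U x) _ _))
    (∑-distrib-+ (summand f) (summand g))
    where
    summand : (List (Fin n) → ℕ) → Fin n → ℕ
    summand h x = if lookup U x then ∑ord k (U [ x ]≔ false) (h ∘ (x ∷_)) else 0

  ∑ord-∑ : ∀ k (U : Subset n) m (g : Fin m → List (Fin n) → ℕ)
         → ∑ord k U (λ σ → ∑[ i < m ] g i σ) ≡ ∑[ i < m ] ∑ord k U (g i)
  ∑ord-∑ k U zero    g = ∑ord-zero k U
  ∑ord-∑ k U (suc m) g = trans (∑ord-+ k U (g zero) _) (cong (∑ord k U (g zero) +_) (∑ord-∑ k U m (g ∘ suc)))

  ∑ord-snoc : ∀ k (U : Subset n) f
            → ∑ord (suc k) U f ≡ ∑[ x < n ] (if lookup U x then ∑ord k (U [ x ]≔ false) (f ∘ (_∷ʳ x)) else 0)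
  ∑ord-snoc zero    U f = refl
  ∑ord-snoc (suc k) U f = begin
    ∑[ y < n ] (if lookup U y then ∑ord (suc k) (U [ y ]≔ false) (f ∘ (y ∷_)) else 0)
      ≡⟨ sum-cong-≗ (λ y → trans (if-congᵗ (lookup U y) λ _ → ∑ord-snoc k (U [ y ]≔ false) (f ∘ (y ∷_)))
                                   (if-∑ (lookup U y) (inner y))) ⟩
    ∑[ y < n ] ∑[ x < n ] (if lookup U y then inner y x else 0)  ≡⟨ ∑-comm (λ y x → if lookup U y then inner y x else 0) ⟩
    ∑[ x < n ] ∑[ y < n ] (if lookup U y then inner y x else 0)  ≡⟨ sum-cong-≗ (λ x → sum-cong-≗ (remove-in-either-order x)) ⟩
    ∑[ x < n ] ∑[ y < n ] (if lookup U x then inner′ x y else 0) ≡⟨ sum-cong-≗ (λ x → if-∑ (lookup U x) (inner′ x)) ⟨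
    ∑[ x < n ] (if lookup U x then ∑ord (suc k) (U [ x ]≔ false) (f ∘ (_∷ʳ x)) else 0)
      ∎
    where
    open ≡-Reasoning
    h : Subset n → Fin n → Fin n → ℕ
    h V y x = ∑ord k V (λ ρ → f (y ∷ ρ ∷ʳ x))
    inner inner′ : Fin n → Fin n → ℕ
    inner  y x = if lookup (U [ y ]≔ false) x then h (U [ y ]≔ false [ x ]≔ false) y x else 0
    inner′ x y = if lookup (U [ x ]≔ false) y then h (U [ x ]≔ false [ y ]≔ false) y x else 0
    if-if : ∀ a b (z : ℕ) → (if a then (if b then z else 0) else 0) ≡ (if b then (if a then z else 0) else 0)
    if-if true  b     z = refl
    if-if false true  z = refl
    if-if false false z = refl
    remove-in-either-order : ∀ x y → (if lookup U y then inner y x else 0) ≡ (if lookup U x then inner′ x y else 0)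
    remove-in-either-order x y with x Finₚ.≟ y
    ... | yes refl = refl
    ... | no x≢y rewrite lookup∘update′ x≢y U false | lookup∘update′ (x≢y ∘ sym) U false =
      trans (if-if (lookup U y) (lookup U x) _)
            (cong (λ V → if lookup U x then (if lookup U y then h V y x else 0) else 0) ([]≔-commutes U y x (x≢y ∘ sym)))

  ∑ord-rotate : ∀ k (U : Subset n) f → ∑ord k U (f ∘ rotate) ≡ ∑ord k U f
  ∑ord-rotate zero    U f = refl
  ∑ord-rotate (suc k) U f = sym (∑ord-snoc k U f)

  ∑ord-rotate^ : ∀ r k (U : Subset n) f → ∑ord k U (f ∘ rotate^ r) ≡ ∑ord k U f
  ∑ord-rotate^ zero    k U f = refl
  ∑ord-rotate^ (suc r) k U f = trans (∑ord-rotate k U (f ∘ rotate^ r)) (∑ord-rotate^ r k U f)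

prefixSet : ∀ {n} → ℕ → List (Fin n) → Subset n
prefixSet a σ = toSubset (take a σ)

module _ {n : ℕ} where

  ∑ord-prefixSet : ∀ k a {U A : Subset n} → ∣ A ∣ ≡ a → ∣ U ∣ ≡ k
                 → (∀ {y} → lookup A y ≡ true → lookup U y ≡ true)
                 → ∑ord k U (λ σ → 𝟙 (prefixSet a σ ≟ₛ A)) ≡ a ! * (k ∸ a) !
  ∑ord-prefixSet k zero {U} {A} ∣A∣≡0 ∣U∣≡k _ = begin
    ∑ord k U (λ _ → 𝟙 (⊥ ≟ₛ A)) ≡⟨ ∑ord-cong k {U} ∣U∣≡k (λ _ _ → 𝟙-yes (⊥ ≟ₛ A) (sym (∣p∣≡0⇒p≡⊥ A ∣A∣≡0))) ⟩
    ∑ord k U (λ _ → 1)          ≡⟨ ∑ord-const k 1 ∣U∣≡k ⟩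
    k ! * 1                     ≡⟨ *-comm (k !) 1 ⟩
    1 * k !                     ∎
    where open ≡-Reasoning
  ∑ord-prefixSet zero (suc a) {U} {A} ∣A∣≡1+a ∣U∣≡0 A⊆U =
    contradiction (subst₂ _≤_ ∣A∣≡1+a ∣U∣≡0 (p⊆q⇒∣p∣≤∣q∣ (lookup-⊆ {p = A} {U} A⊆U))) λ ()
  ∑ord-prefixSet (suc k) (suc a) {U} {A} ∣A∣≡1+a ∣U∣≡1+k A⊆U = begin
    ∑[ x < n ] (if lookup U x then ∑ord k (U [ x ]≔ false) (λ τ → 𝟙 (prefixSet a τ [ x ]≔ true ≟ₛ A)) else 0)
      ≡⟨ sum-cong-≗ first-entry ⟩
    ∑[ x < n ] (if lookup A x then a ! * (k ∸ a) ! else 0) ≡⟨ ∑-if-lookup A _ ⟩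
    ∣ A ∣ * (a ! * (k ∸ a) !)                             ≡⟨ cong (_* (a ! * (k ∸ a) !)) ∣A∣≡1+a ⟩
    suc a * (a ! * (k ∸ a) !)                             ≡⟨ *-assoc (suc a) (a !) ((k ∸ a) !) ⟨
    suc a ! * (k ∸ a) !                                   ∎
    where
    open ≡-Reasoning
    -- x ∷ τ passes through A iff x ∈ A and τ passes through A without x.
    first-entry : ∀ x → (if lookup U x then ∑ord k (U [ x ]≔ false) (λ τ → 𝟙 (prefixSet a τ [ x ]≔ true ≟ₛ A)) else 0)
                      ≡ (if lookup A x then a ! * (k ∸ a) ! else 0)
    first-entry x with lookup A x in x∈A | lookup U x in x∈U
    ... | true  | false = contradiction (trans (sym (A⊆U x∈A)) x∈U) λ ()
    ... | false | false = refl
    ... | false | true  = trans (∑ord-cong k (∣p∣≡1+m⇒∣p[x]≔false∣≡m U x x∈U ∣U∣≡1+k) λ τ _ → 𝟙-no (_ ≟ₛ A) x-missing)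
                                (∑ord-zero k (U [ x ]≔ false))
      where
      x-missing : ∀ {P} → P [ x ]≔ true ≢ A
      x-missing {P} P+x≡A = contradiction (trans (sym (lookup∘update x P true)) (trans (cong (λ V → lookup V x) P+x≡A) x∈A)) λ ()
    ... | true  | true  = begin
      ∑ord k (U [ x ]≔ false) (λ τ → 𝟙 (prefixSet a τ [ x ]≔ true ≟ₛ A))
        ≡⟨ ∑ord-cong k ∣U-x∣≡k (λ τ τ-ord → 𝟙-cong (_ ≟ₛ A) (_ ≟ₛ _)
             (p[x]≔true≡q⇒p≡q[x]≔false x (x∉prefix τ-ord)) (p≡q[x]≔false⇒p[x]≔true≡q x x∈A)) ⟩
      ∑ord k (U [ x ]≔ false) (λ τ → 𝟙 (prefixSet a τ ≟ₛ A [ x ]≔ false))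
        ≡⟨ ∑ord-prefixSet k a (∣p∣≡1+m⇒∣p[x]≔false∣≡m A x x∈A ∣A∣≡1+a) ∣U-x∣≡k ([x]≔false-⊆ {p = A} {U} x A⊆U) ⟩
      a ! * (k ∸ a) ! ∎
      where
      ∣U-x∣≡k : ∣ U [ x ]≔ false ∣ ≡ k
      ∣U-x∣≡k = ∣p∣≡1+m⇒∣p[x]≔false∣≡m U x x∈U ∣U∣≡1+k
      x∉prefix : ∀ {τ} → IsOrdering k (U [ x ]≔ false) τ → lookup (prefixSet a τ) x ≡ false
      x∉prefix {τ} τ-ord with lookup (prefixSet a τ) x in x∈P
      ... | false = refl
      ... | true  = contradiction (trans (sym (IsOrdering.sound τ-ord (∈-take τ (lookup-toSubset⇒∈ (take a τ) x∈P))))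
                                         (lookup∘update x U false)) λ ()

prefixSet-mono : ∀ {n a b} (σ : List (Fin n)) → a ≤ b → prefixSet a σ ⊆ prefixSet b σ
prefixSet-mono σ a≤b = toSubset-⊆ (∈-take-mono σ a≤b)

lookup-injective : ∀ {A : Set} {xs : List A} → Unique xs → ∀ {i j} → List.lookup xs i ≡ List.lookup xs j → i ≡ j
lookup-injective (_    ∷ _)  {zero}  {zero}  _ = refl
lookup-injective (x∉xs ∷ _)  {zero}  {suc j} e = contradiction e (All.lookup x∉xs (∈-lookup j))
lookup-injective (x∉xs ∷ _)  {suc i} {zero}  e = contradiction (sym e) (All.lookup x∉xs (∈-lookup i))
lookup-injective (_    ∷ xs) {suc i} {suc j} e = cong suc (lookup-injective xs e)

module Chains {n} {F : List (Subset n)} (F-unique : Unique F) (sperner : Sperner F) where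

  open import Data.List.Membership.DecPropositional (_≟ₛ_ {n}) using (_∈?_)

  member : Fin (length F) → Subset n
  member = List.lookup F

  Meets : List (Fin n) → Set
  Meets σ = ∃ λ ℓ → ℓ < suc n × prefixSet ℓ σ ∈ F

  meets? : ∀ σ → Dec (Meets σ)
  meets? σ = anyUpTo? (λ ℓ → prefixSet ℓ σ ∈? F) (suc n)

  misses : List (Fin n) → ℕ
  misses σ = 𝟙 (¬? (meets? σ))

  passes : List (Fin n) → Fin (length F) → ℕ
  passes σ i = 𝟙 (prefixSet ∣ member i ∣ σ ≟ₛ member i)

  passed-sets-equal : ∀ {σ B C} → B ∈ F → C ∈ F → prefixSet ∣ B ∣ σ ≡ B → prefixSet ∣ C ∣ σ ≡ C → B ≡ C
  passed-sets-equal {σ} {B} {C} B∈F C∈F σ→B σ→C with B ≟ₛ C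
  ... | yes B≡C = B≡C
  ... | no B≢C with ≤-total ∣ B ∣ ∣ C ∣
  ...   | inj₁ ∣B∣≤∣C∣ = ⊥-elim (sperner B∈F C∈F B≢C λ {x} → subst₂ _⊆_ σ→B σ→C (prefixSet-mono σ ∣B∣≤∣C∣) {x})
  ...   | inj₂ ∣C∣≤∣B∣ = ⊥-elim (sperner C∈F B∈F (B≢C ∘ sym) λ {x} → subst₂ _⊆_ σ→C σ→B (prefixSet-mono σ ∣C∣≤∣B∣) {x})

  passes-at-most-one : ∀ σ → ∑[ i < length F ] passes σ i ≤ 1
  passes-at-most-one σ = ∑-𝟙≤1 (λ i → prefixSet ∣ member i ∣ σ ≟ₛ member i)
    (λ {i} {j} σ→Fi σ→Fj → lookup-injective F-unique (passed-sets-equal (∈-lookup i) (∈-lookup j) σ→Fi σ→Fj))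

  passes+misses≤1 : ∀ σ → ∑[ i < length F ] passes σ i + misses σ ≤ 1
  passes+misses≤1 σ with meets? σ
  ... | yes _      = ≤-trans (≤-reflexive (+-identityʳ _)) (passes-at-most-one σ)
  ... | no ¬meets = ≤-reflexive (cong (_+ 1) (∑-zero λ i → 𝟙-no (_ ≟ₛ member i) λ σ→Fi →
                      ¬meets (∣ member i ∣ , s≤s (∣p∣≤n (member i)) , subst (_∈ F) (sym σ→Fi) (∈-lookup i))))

  lym : ∑[ i < length F ] (∣ member i ∣ ! * (n ∸ ∣ member i ∣) !) + ∑ord n ⊤ misses ≤ n !
  lym = begin
    ∑[ i < length F ] (∣ member i ∣ ! * (n ∸ ∣ member i ∣) !) + ∑ord n ⊤ misses
      ≡⟨ cong (_+ ∑ord n ⊤ misses) (sum-cong-≗ λ i →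
           ∑ord-prefixSet n ∣ member i ∣ refl (∣⊤∣≡n n) (λ {y} _ → lookup-⊤ y)) ⟨
    ∑[ i < length F ] ∑ord n ⊤ (λ σ → passes σ i) + ∑ord n ⊤ misses
      ≡⟨ cong (_+ ∑ord n ⊤ misses) (∑ord-∑ n ⊤ (length F) (λ i σ → passes σ i)) ⟨
    ∑ord n ⊤ (λ σ → ∑[ i < length F ] passes σ i) + ∑ord n ⊤ misses
      ≡⟨ ∑ord-+ n ⊤ _ misses ⟨
    ∑ord n ⊤ (λ σ → ∑[ i < length F ] passes σ i + misses σ)
      ≤⟨ ∑ord-mono n (∣⊤∣≡n n) (λ σ _ → passes+misses≤1 σ) ⟩
    ∑ord n ⊤ (λ _ → 1)  ≡⟨ ∑ord-const n 1 (∣⊤∣≡n n) ⟩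
    n ! * 1             ≡⟨ *-identityʳ (n !) ⟩
    n !                 ∎
    where open ≤-Reasoning

  level-never-drops : ∀ {σ ℓ ℓ′} → IsOrdering n ⊤ σ → ℓ ≤ n
                    → prefixSet ℓ σ ∈ F → prefixSet ℓ′ (rotate σ) ∈ F → ℓ ≤ ℓ′
  level-never-drops {[]} σ-ord ℓ≤n _ _ = ≤-trans (subst (_ ≤_) (sym (IsOrdering.length≡ σ-ord)) ℓ≤n) z≤n
  level-never-drops {x ∷ ρ} {zero}   _     _   _   _    = z≤n
  level-never-drops {x ∷ ρ} {suc ℓ₁} {ℓ′} σ-ord ℓ≤n B∈F B′∈F = ≮⇒≥ no-drop
    where
    open IsOrdering σ-ord
    no-drop : ¬ ℓ′ < suc ℓ₁
    no-drop (s≤s ℓ′≤ℓ₁) = sperner B′∈F B∈F B′≢B B′⊆B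
      where
      ℓ′≤ρ : ℓ′ ≤ length ρ
      ℓ′≤ρ = ≤-trans ℓ′≤ℓ₁ (≤-pred (subst (suc ℓ₁ ≤_) (sym length≡) ℓ≤n))
      take-rotate : take ℓ′ (ρ ∷ʳ x) ≡ take ℓ′ ρ
      take-rotate = take-++ˡ ρ (x ∷ []) ℓ′≤ρ
      B′⊆B : prefixSet ℓ′ (ρ ∷ʳ x) ⊆ prefixSet (suc ℓ₁) (x ∷ ρ)
      B′⊆B = toSubset-⊆ λ y∈ → there (∈-take-mono ρ ℓ′≤ℓ₁ (subst (_ ∈_) take-rotate y∈))
      B′≢B : prefixSet ℓ′ (ρ ∷ʳ x) ≢ prefixSet (suc ℓ₁) (x ∷ ρ)
      B′≢B B′≡B = All.lookup x∉ρ (∈-take ρ (subst (x ∈_) take-rotate x∈B′)) refl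
        where
        x∉ρ = AllPairs.head unique
        x∈B′ : x ∈ take ℓ′ (ρ ∷ʳ x)
        x∈B′ = lookup-toSubset⇒∈ _ (trans (cong (λ V → lookup V x) B′≡B) (∈⇒lookup-toSubset {xs = x ∷ take ℓ₁ ρ} (here refl)))

  rotations-miss-or-stay-above : ∀ r {t σ ℓ} → IsOrdering n ⊤ σ → t ≤ ℓ → ℓ ≤ n → prefixSet ℓ σ ∈ F
    → 0 < ∑[ i < r ] misses (rotate^ (suc (toℕ i)) σ)
    ⊎ ∃ λ ℓ′ → t ≤ ℓ′ × ℓ′ ≤ n × prefixSet ℓ′ (rotate^ r σ) ∈ F
  rotations-miss-or-stay-above zero    _     t≤ℓ ℓ≤n B∈F = inj₂ (_ , t≤ℓ , ℓ≤n , B∈F)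
  rotations-miss-or-stay-above (suc r) {σ = σ} σ-ord t≤ℓ ℓ≤n B∈F
    with meets? (rotate σ)
  ... | no _ = inj₁ z<s
  ... | yes (ℓ′ , ℓ′<1+n , B′∈F) = rotations-miss-or-stay-above r (IsOrdering-resp-↭ (rotate-↭ σ) σ-ord)
    (≤-trans t≤ℓ (level-never-drops σ-ord ℓ≤n B∈F B′∈F)) (≤-pred ℓ′<1+n) B′∈F

  module MiddleLayer (noncover : Non2Covering F) {m} (n≡t+t : n ≡ suc m + suc m) where

    t : ℕ
    t = suc m

    t≤n : t ≤ n
    t≤n = subst (t ≤_) (sym n≡t+t) (m≤m+n t t)

    n∸t≡t : n ∸ t ≡ t
    n∸t≡t = trans (cong (_∸ t) n≡t+t) (m+n∸m≡n t t)

    some-rotation-misses : ∀ {σ} → IsOrdering n ⊤ σ → prefixSet t σ ∈ F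
                         → 0 < ∑[ i < t ] misses (rotate^ (suc (toℕ i)) σ)
    -- After t rotations the first t entries are the last t entries of σ, the complement of A.
    some-rotation-misses {σ} σ-ord A∈F with rotations-miss-or-stay-above t σ-ord ≤-refl t≤n A∈F
    ... | inj₁ some-miss = some-miss
    ... | inj₂ (ℓ , t≤ℓ , _ , B∈F) = contradiction (lookup-∪≡⊤ covered) (noncover A∈F B∈F)
      where
      open IsOrdering σ-ord
      t≤σ : t ≤ length σ
      t≤σ = subst (t ≤_) (sym length≡) t≤n
      ∣drop∣≡t : length (drop t σ) ≡ t
      ∣drop∣≡t = trans (length-drop t σ) (trans (cong (_∸ t) length≡) n∸t≡t)
      drop⊆B : ∀ {y} → y ∈ drop t σ → y ∈ take ℓ (rotate^ t σ)
      drop⊆B {y} y∈ = ∈-take-mono (rotate^ t σ) t≤ℓ (subst (y ∈_) (sym take-t-rotated) y∈)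
        where
        take-t-rotated : take t (rotate^ t σ) ≡ drop t σ
        take-t-rotated = begin
          take t (rotate^ t σ)                 ≡⟨ cong (take t) (rotate^≡drop++take t σ t≤σ) ⟩
          take t (drop t σ ++ take t σ)        ≡⟨ take-++ˡ (drop t σ) (take t σ) (≤-reflexive (sym ∣drop∣≡t)) ⟩
          take t (drop t σ)                    ≡⟨ take-all t (drop t σ) (≤-reflexive ∣drop∣≡t) ⟩
          drop t σ                             ∎
          where open ≡-Reasoning
      covered : ∀ y → lookup (prefixSet t σ) y ≡ true ⊎ lookup (prefixSet ℓ (rotate^ t σ)) y ≡ true
      covered y with ∈-++⁻ (take t σ) (subst (y ∈_) (sym (take++drop≡id t σ)) (complete (lookup-⊤ y)))
      ... | inj₁ y∈take = inj₁ (∈⇒lookup-toSubset y∈take)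
      ... | inj₂ y∈drop = inj₂ (∈⇒lookup-toSubset (drop⊆B y∈drop))

    passes-middle : List (Fin n) → Fin (length F) → ℕ
    passes-middle σ i = if does (∣ member i ∣ ≟ t) then passes σ i else 0

    ∑ord-passes-middle : ∀ i (middle? : Dec (∣ member i ∣ ≡ t))
      → t * (if does middle? then m ! * t ! else 0) ≡ ∑ord n ⊤ (λ σ → if does middle? then passes σ i else 0)
    ∑ord-passes-middle i (no _)       = trans (*-zeroʳ t) (sym (∑ord-zero n ⊤))
    ∑ord-passes-middle i (yes ∣Fi∣≡t) = begin
      t * (m ! * t !)                             ≡⟨ *-assoc t (m !) (t !) ⟨
      t ! * t !                                   ≡⟨ cong₂ (λ a b → a ! * b !) (sym ∣Fi∣≡t) (trans (sym n∸t≡t) (cong (n ∸_) (sym ∣Fi∣≡t))) ⟩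
      ∣ member i ∣ ! * (n ∸ ∣ member i ∣) !       ≡⟨ ∑ord-prefixSet n ∣ member i ∣ refl (∣⊤∣≡n n) (λ {y} _ → lookup-⊤ y) ⟨
      ∑ord n ⊤ (λ σ → passes σ i)                 ∎
      where open ≡-Reasoning

    passes-middle⇒prefix∈F : ∀ σ i (middle? : Dec (∣ member i ∣ ≡ t))
      → 0 < (if does middle? then passes σ i else 0) → prefixSet t σ ∈ F
    passes-middle⇒prefix∈F σ i (yes ∣Fi∣≡t) pos = subst (λ a → prefixSet a σ ∈ F) ∣Fi∣≡t
                         (subst (_∈ F) (sym (𝟙-pos (prefixSet ∣ member i ∣ σ ≟ₛ member i) pos)) (∈-lookup i))

    passes-middle≤rotated-misses : ∀ σ → IsOrdering n ⊤ σ
      → ∑[ i < length F ] passes-middle σ i ≤ ∑[ r < t ] misses (rotate^ (suc (toℕ r)) σ)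
    passes-middle≤rotated-misses σ σ-ord = x≤1⇒x≤y
      (≤-trans (∑-mono-≤ λ i → if-≤ (does (∣ member i ∣ ≟ t)) (passes σ i)) (passes-at-most-one σ))
      λ pos → let (i , pos-i) = ∑-positive (passes-middle σ) pos in
              some-rotation-misses σ-ord (passes-middle⇒prefix∈F σ i (∣ member i ∣ ≟ t) pos-i)

    middle-layer≤misses : ∑[ i < length F ] (if does (∣ member i ∣ ≟ t) then m ! * t ! else 0) ≤ ∑ord n ⊤ misses
    middle-layer≤misses = *-cancelˡ-≤ t (begin
      t * ∑[ i < length F ] extra i                          ≡⟨ *-distribˡ-sum t extra ⟩
      ∑[ i < length F ] (t * extra i)                        ≡⟨ sum-cong-≗ (λ i → ∑ord-passes-middle i (∣ member i ∣ ≟ t)) ⟩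
      ∑[ i < length F ] ∑ord n ⊤ (λ σ → passes-middle σ i)   ≡⟨ ∑ord-∑ n ⊤ (length F) (λ i σ → passes-middle σ i) ⟨
      ∑ord n ⊤ (λ σ → ∑[ i < length F ] passes-middle σ i)
        ≤⟨ ∑ord-mono n (∣⊤∣≡n n) passes-middle≤rotated-misses ⟩
      ∑ord n ⊤ (λ σ → ∑[ r < t ] misses (rotate^ (suc (toℕ r)) σ))
        ≡⟨ ∑ord-∑ n ⊤ t (λ r → misses ∘ rotate^ (suc (toℕ r))) ⟩
      ∑[ r < t ] ∑ord n ⊤ (misses ∘ rotate^ (suc (toℕ r)))  ≡⟨ sum-cong-≗ {t} (λ r → ∑ord-rotate^ (suc (toℕ r)) n ⊤ misses) ⟩
      ∑[ r < t ] ∑ord n ⊤ misses                            ≡⟨ ∑-const t (∑ord n ⊤ misses) ⟩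
      t * ∑ord n ⊤ misses                                   ∎)
      where
      open ≤-Reasoning
      extra : Fin (length F) → ℕ
      extra i = if does (∣ member i ∣ ≟ t) then m ! * t ! else 0

nCk*k![n∸k]!≡n! : ∀ {n k} → k ≤ n → (n C k) * (k ! * (n ∸ k) !) ≡ n !
nCk*k![n∸k]!≡n! {n} {k} k≤n = trans (cong (_* (k ! * (n ∸ k) !)) (nCk≡n!/k![n-k]! k≤n)) (m/n*n≡m (k![n∸k]!∣n! k≤n))
  where instance _ = k !* (n ∸ k) !≢0

k![n∸k]!-sym : ∀ {n k} → k ≤ n → (n ∸ k) ! * (n ∸ (n ∸ k)) ! ≡ k ! * (n ∸ k) !
k![n∸k]!-sym {n} {k} k≤n = trans (cong (λ j → (n ∸ k) ! * j !) (m∸[m∸n]≡n k≤n)) (*-comm ((n ∸ k) !) (k !))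

k![n∸k]!-step : ∀ {n k} → suc (k + k) ≤ n → suc k ! * (n ∸ suc k) ! ≤ k ! * (n ∸ k) !
k![n∸k]!-step {n} {k} 2k<n = begin
  suc k * k ! * (n ∸ suc k) !         ≡⟨ cong (_* (n ∸ suc k) !) (*-comm (suc k) (k !)) ⟩
  k ! * suc k * (n ∸ suc k) !         ≡⟨ *-assoc (k !) (suc k) ((n ∸ suc k) !) ⟩
  k ! * (suc k * (n ∸ suc k) !)       ≤⟨ *-monoʳ-≤ (k !) (*-monoˡ-≤ ((n ∸ suc k) !) 1+k≤n∸k) ⟩
  k ! * ((n ∸ k) * (n ∸ suc k) !)     ≡⟨ cong (λ j → k ! * (j * (n ∸ suc k) !)) n∸k≡1+[n∸1+k] ⟩
  k ! * suc (n ∸ suc k) !             ≡⟨ cong (λ j → k ! * j !) n∸k≡1+[n∸1+k] ⟨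
  k ! * (n ∸ k) !                     ∎
  where
  open ≤-Reasoning
  n∸k≡1+[n∸1+k] : n ∸ k ≡ suc (n ∸ suc k)
  n∸k≡1+[n∸1+k] = +-∸-assoc 1 (≤-trans (s≤s (m≤m+n k k)) 2k<n)
  1+k≤n∸k : suc k ≤ n ∸ k
  1+k≤n∸k = subst (_≤ n ∸ k) (m+n∸n≡m (suc k) k) (∸-monoˡ-≤ k 2k<n)

k![n∸k]!-anti : ∀ {n j k} → j ≤ k → k + k ≤ suc n → k ! * (n ∸ k) ! ≤ j ! * (n ∸ j) !
k![n∸k]!-anti j≤k = anti (≤⇒≤′ j≤k)
  where
  anti : ∀ {n j k} → j ≤′ k → k + k ≤ suc n → k ! * (n ∸ k) ! ≤ j ! * (n ∸ j) !
  anti ≤′-refl _ = ≤-refl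
  anti {n} {k = suc k} (≤′-step j≤′k) 2k+2≤n+1 = ≤-trans (k![n∸k]!-step {k = k} 2k<n) (anti j≤′k (≤-trans (n≤1+n (k + k)) (m≤n⇒m≤1+n 2k<n)))
    where
    2k<n : suc (k + k) ≤ n
    2k<n = ≤-pred (subst (_≤ suc n) (cong suc (+-suc k k)) 2k+2≤n+1)

k![n∸k]!-min : ∀ {n m a} → m + m ≤ suc n → a ≤ n → a ≤ m ⊎ n ≤ a + m → m ! * (n ∸ m) ! ≤ a ! * (n ∸ a) !
k![n∸k]!-min 2m≤n+1 a≤n (inj₁ a≤m) = k![n∸k]!-anti a≤m 2m≤n+1
k![n∸k]!-min {n} {m} {a} 2m≤n+1 a≤n (inj₂ n≤a+m) =
  ≤-trans (k![n∸k]!-anti n∸a≤m 2m≤n+1) (≤-reflexive (k![n∸k]!-sym a≤n))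
  where
  n∸a≤m : n ∸ a ≤ m
  n∸a≤m = subst (n ∸ a ≤_) (m+n∸m≡n a m) (∸-monoˡ-≤ a n≤a+m)

m![n∸m]!≤-odd : ∀ {n m a} → n ≡ suc (m + m) → a ≤ n → m ! * (n ∸ m) ! ≤ a ! * (n ∸ a) !
m![n∸m]!≤-odd {n} {m} {a} n≡2m+1 a≤n = k![n∸k]!-min 2m≤n+1 a≤n below-or-above
  where
  2m≤n+1 : m + m ≤ suc n
  2m≤n+1 = subst (m + m ≤_) (cong suc (sym n≡2m+1)) (≤-trans (n≤1+n _) (n≤1+n _))
  below-or-above : a ≤ m ⊎ n ≤ a + m
  below-or-above with a ≤? m
  ... | yes a≤m = inj₁ a≤m
  ... | no  a≰m = inj₂ (subst (_≤ a + m) (sym n≡2m+1) (+-monoˡ-≤ m (≰⇒> a≰m)))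

m![n∸m]!≤-even : ∀ {n m a} → n ≡ suc m + suc m → a ≤ n → a ≢ suc m → m ! * (n ∸ m) ! ≤ a ! * (n ∸ a) !
m![n∸m]!≤-even {n} {m} {a} n≡2m+2 a≤n a≢1+m = k![n∸k]!-min 2m≤n+1 a≤n below-or-above
  where
  2m≤n+1 : m + m ≤ suc n
  2m≤n+1 = ≤-trans (+-monoʳ-≤ m (n≤1+n m)) (≤-trans (n≤1+n _) (≤-trans (≤-reflexive (sym n≡2m+2)) (n≤1+n n)))
  below-or-above : a ≤ m ⊎ n ≤ a + m
  below-or-above with a ≤? m
  ... | yes a≤m = inj₁ a≤m
  ... | no  a≰m = inj₂ (subst (_≤ a + m) (sym (trans n≡2m+2 (cong suc (+-suc m m))))
                         (+-monoˡ-≤ m (≤∧≢⇒< (≰⇒> a≰m) (a≢1+m ∘ sym))))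

m![n∸m]!≡-even : ∀ {n m} → n ≡ suc m + suc m → m ! * (n ∸ m) ! ≡ suc m ! * (n ∸ suc m) ! + m ! * suc m !
m![n∸m]!≡-even {n} {m} n≡2m+2 = begin
  m ! * (n ∸ m) !                         ≡⟨ cong (λ j → m ! * j !) n∸m≡2+m ⟩
  m ! * suc (suc m) !                     ≡⟨ solve 2 (λ m x → x :* ((con 2 :+ m) :* ((con 1 :+ m) :* x))
                                                  := ((con 1 :+ m) :* x) :* ((con 1 :+ m) :* x) :+ x :* ((con 1 :+ m) :* x))
                                                refl m (m !) ⟩
  suc m ! * suc m ! + m ! * suc m !       ≡⟨ cong (λ j → suc m ! * j ! + m ! * suc m !) n∸1+m≡1+m ⟨
  suc m ! * (n ∸ suc m) ! + m ! * suc m ! ∎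
  where
  open ≡-Reasoning
  open +-*-Solver
  n∸m≡2+m : n ∸ m ≡ suc (suc m)
  n∸m≡2+m = trans (cong (_∸ m) (trans n≡2m+2 (sym (+-suc m (suc m))))) (m+n∸m≡n m (suc (suc m)))
  n∸1+m≡1+m : n ∸ suc m ≡ suc m
  n∸1+m≡1+m = trans (cong (_∸ suc m) n≡2m+2) (m+n∸m≡n (suc m) (suc m))

weighted-count-bound : ∀ {L} (W : Fin L → ℕ) {N M K} .{{_ : NonZero N}}
  → ∑[ i < L ] W i ≤ N → (∀ i → N ≤ M * W i) → ∀ i₀ → N ≤ K * W i₀ → L * K ≤ (K ∸ 1) * M + K
weighted-count-bound W {N} {K = zero} _ _ i₀ N≤0 = contradiction (n≤0⇒n≡0 N≤0) (≢-nonZero⁻¹ N)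
weighted-count-bound {suc L} W {N} {M} {suc K} ∑W≤N N≤MW i₀ N≤KW₀ = begin
  suc K + L * suc K    ≡⟨ +-comm (suc K) (L * suc K) ⟩
  L * suc K + suc K    ≡⟨ cong (_+ suc K) (*-comm L (suc K)) ⟩
  suc K * L + suc K    ≤⟨ +-monoˡ-≤ (suc K) (+-cancelˡ-≤ M _ _ (*-cancelˡ-≤ N key)) ⟩
  K * M + suc K        ∎
  where
  open ≤-Reasoning
  open +-*-Solver
  rest : ℕ
  rest = ∑[ j < L ] W (punchIn i₀ j)
  L*N≤M*rest : L * N ≤ M * rest
  L*N≤M*rest = begin
    L * N                       ≡⟨ ∑-const L N ⟨
    ∑[ j < L ] N                ≤⟨ ∑-mono-≤ (λ j → N≤MW (punchIn i₀ j)) ⟩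
    ∑[ j < L ] (M * W (punchIn i₀ j)) ≡⟨ *-distribˡ-sum M (W ∘ punchIn i₀) ⟨
    M * rest                    ∎
  key : N * (M + suc K * L) ≤ N * (suc K * M)
  key = begin
    N * (M + suc K * L)                 ≡⟨ solve 4 (λ N M K L → N :* (M :+ K :* L) := M :* N :+ K :* (L :* N)) refl N M (suc K) L ⟩
    M * N + suc K * (L * N)             ≤⟨ +-mono-≤ (*-monoʳ-≤ M N≤KW₀) (*-monoʳ-≤ (suc K) L*N≤M*rest) ⟩
    M * (suc K * W i₀) + suc K * (M * rest)
      ≡⟨ solve 5 (λ M K W R N → M :* (K :* W) :+ K :* (M :* R) := K :* M :* (W :+ R)) refl M (suc K) (W i₀) rest N ⟩
    suc K * M * (W i₀ + rest)          ≡⟨ cong (suc K * M *_) (sum-remove {i = i₀} W) ⟨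
    suc K * M * ∑[ i < suc L ] W i     ≤⟨ *-monoʳ-≤ (suc K * M) ∑W≤N ⟩
    suc K * M * N                      ≡⟨ *-comm (suc K * M) N ⟩
    N * (suc K * M)                    ∎

middle-split : ∀ n′ → let m = n′ / 2 in suc n′ ≡ suc (m + m) ⊎ suc n′ ≡ suc m + suc m
middle-split n′ with n′ % 2 | m%n<n n′ 2 | m≡m%n+[m/n]*n n′ 2
... | zero        | _            | n′≡ =
  inj₁ (cong suc (trans n′≡ (solve 1 (λ m → m :* con 2 := m :+ m) refl (n′ / 2))))
  where open +-*-Solver
... | suc zero    | _            | n′≡ =
  inj₂ (cong suc (trans n′≡ (solve 1 (λ m → con 1 :+ m :* con 2 := m :+ (con 1 :+ m)) refl (n′ / 2))))
  where open +-*-Solver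
... | suc (suc _) | s≤s (s≤s ()) | _

record Weighting {n} (F : List (Subset n)) (m : ℕ) : Set where
  field
    weight        : Subset n → ℕ
    total≤n!      : ∑[ i < length F ] weight (List.lookup F i) ≤ n !
    middle≤weight : ∀ B → m ! * (n ∸ m) ! ≤ weight B
    own≤weight    : ∀ B → ∣ B ∣ ! * (n ∸ ∣ B ∣) ! ≤ weight B

module _ {n} {F : List (Subset n)} (F-unique : Unique F) (sperner : Sperner F) where

  open Chains F-unique sperner

  odd-weighting : ∀ {m} → n ≡ suc (m + m) → Weighting F m
  odd-weighting {m} n≡2m+1 = record
    { weight        = λ B → ∣ B ∣ ! * (n ∸ ∣ B ∣) !
    ; total≤n!      = ≤-trans (m≤m+n _ _) lym
    ; middle≤weight = λ B → m![n∸m]!≤-odd {m = m} n≡2m+1 (∣p∣≤n B)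
    ; own≤weight    = λ _ → ≤-refl
    }

  even-weighting : Non2Covering F → ∀ {m} → n ≡ suc m + suc m → Weighting F m
  even-weighting noncover {m} n≡2m+2 = record
    { weight        = λ B → ∣ B ∣ ! * (n ∸ ∣ B ∣) ! + extra B
    ; total≤n!      = total
    ; middle≤weight = λ B → middle≤ B (∣ B ∣ ≟ suc m)
    ; own≤weight    = λ B → m≤m+n _ (extra B)
    }
    where
    open MiddleLayer noncover n≡2m+2
    -- With t = m + 1, a t-set gets m! t! = t! t! / t, which middle-layer≤misses charges to the
    -- orderings meeting no member; it raises the weight t! t! of a t-set to m! (t + 1)! = m! (n − m)!.
    extra : Subset n → ℕ
    extra B = if does (∣ B ∣ ≟ suc m) then m ! * suc m ! else 0
    total : ∑[ i < length F ] (∣ member i ∣ ! * (n ∸ ∣ member i ∣) ! + extra (member i)) ≤ n !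
    total = begin
      ∑[ i < length F ] (∣ member i ∣ ! * (n ∸ ∣ member i ∣) ! + extra (member i))
        ≡⟨ ∑-distrib-+ (λ i → ∣ member i ∣ ! * (n ∸ ∣ member i ∣) !) (extra ∘ member) ⟩
      ∑[ i < length F ] (∣ member i ∣ ! * (n ∸ ∣ member i ∣) !) + ∑[ i < length F ] extra (member i)
        ≤⟨ +-monoʳ-≤ _ middle-layer≤misses ⟩
      ∑[ i < length F ] (∣ member i ∣ ! * (n ∸ ∣ member i ∣) !) + ∑ord n ⊤ misses
        ≤⟨ lym ⟩
      n ! ∎
      where open ≤-Reasoning
    middle≤ : ∀ B (middle? : Dec (∣ B ∣ ≡ suc m))
            → m ! * (n ∸ m) ! ≤ ∣ B ∣ ! * (n ∸ ∣ B ∣) ! + (if does middle? then m ! * suc m ! else 0)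
    middle≤ B (yes ∣B∣≡1+m) = ≤-reflexive
      (trans (m![n∸m]!≡-even n≡2m+2) (cong (λ a → a ! * (n ∸ a) ! + m ! * suc m !) (sym ∣B∣≡1+m)))
    middle≤ B (no ∣B∣≢1+m)  = ≤-trans (m![n∸m]!≤-even n≡2m+2 (∣p∣≤n B) ∣B∣≢1+m) (m≤m+n _ 0)

weighting : ∀ {n′} {F : List (Subset (suc n′))} → Unique F → Sperner F → Non2Covering F → Weighting F (n′ / 2)
weighting {n′} F-unique sperner noncover with middle-split n′
... | inj₁ odd  = odd-weighting F-unique sperner odd
... | inj₂ even = even-weighting F-unique sperner noncover even

n!≤nCk*w : ∀ {n k w} → k ≤ n → k ! * (n ∸ k) ! ≤ w → n ! ≤ (n C k) * w
n!≤nCk*w {n} {k} k≤n k![n∸k]!≤w = subst (_≤ (n C k) * _) (nCk*k![n∸k]!≡n! k≤n) (*-monoʳ-≤ (n C k) k![n∸k]!≤w)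

*≤⇒≤/ : ∀ {m o} q .{{_ : NonZero q}} → m * q ≤ o → m ≤ o / q
*≤⇒≤/ {m} {o} q m*q≤o = subst (_≤ o / q) (m*n/n≡m m q) (/-monoˡ-≤ q m*q≤o)

[pn/q]+[pn/q]≤n : ∀ {p q} n .{{_ : NonZero q}} → 2 * p ≤ q → (p * n) / q + (p * n) / q ≤ n
[pn/q]+[pn/q]≤n {p} {q} n 2p≤q = *-cancelʳ-≤ _ n q (begin
  (k + k) * q          ≡⟨ *-distribʳ-+ q k k ⟩
  k * q + k * q        ≤⟨ +-mono-≤ (m/n*n≤m (p * n) q) (m/n*n≤m (p * n) q) ⟩
  p * n + p * n        ≡⟨ solve 2 (λ p n → p :* n :+ p :* n := con 2 :* p :* n) refl p n ⟩
  2 * p * n            ≤⟨ *-monoˡ-≤ n 2p≤q ⟩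
  q * n                ≡⟨ *-comm q n ⟩
  n * q                ∎)
  where
  open ≤-Reasoning
  open +-*-Solver
  k : ℕ
  k = (p * n) / q

proposition3p3 : (n p q : ℕ) → .{{_ : NonZero q}} → 0 < p → 2 * p < q
    → (F : List (Subset n)) → Unique F → Sperner F → Non2Covering F
    → Σ (Subset n) (λ A₀ → A₀ ∈ F × ∣ A₀ ∣ * q ≤ p * n)
    → length F * (n C ((p * n) / q))
      ≤ ((n C ((p * n) / q)) ∸ 1) * (n C ((n ∸ 1) / 2)) + n C ((p * n) / q)
proposition3p3 zero _ _ _ _ _ _ _ noncover ([] , A₀∈F , _) = ⊥-elim (noncover A₀∈F A₀∈F refl)
proposition3p3 n@(suc n′) p q _ 2p<q F F-unique sperner noncover (A₀ , A₀∈F , ∣A₀∣q≤pn) =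
  weighted-count-bound (weight ∘ List.lookup F) {{n !≢0}} total≤n!
    (λ i → n!≤nCk*w m≤n (middle≤weight (List.lookup F i))) (Any.index A₀∈F) A₀-bound
  where
  open Weighting (weighting F-unique sperner noncover)
  open ≤-Reasoning
  k : ℕ
  k = (p * n) / q
  m≤n : n′ / 2 ≤ n
  m≤n = ≤-trans (m/n≤m n′ 2) (n≤1+n n′)
  k+k≤n : k + k ≤ n
  k+k≤n = [pn/q]+[pn/q]≤n {p} n (<⇒≤ 2p<q)
  A₀-bound : n ! ≤ (n C k) * weight (List.lookup F (Any.index A₀∈F))
  A₀-bound = n!≤nCk*w (≤-trans (m≤m+n k k) k+k≤n) (begin
    k ! * (n ∸ k) !            ≤⟨ k![n∸k]!-anti (*≤⇒≤/ {∣ A₀ ∣} q ∣A₀∣q≤pn) (≤-trans k+k≤n (n≤1+n n)) ⟩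
    ∣ A₀ ∣ ! * (n ∸ ∣ A₀ ∣) !  ≤⟨ own≤weight A₀ ⟩
    weight A₀                  ≡⟨ cong weight (lookup-index A₀∈F) ⟩
    weight (List.lookup F (Any.index A₀∈F)) ∎)
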